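{- Let $I$ be a countable instance over a finite signature with $\mathrm{cw}(I)=n\in\mathbb{N}$, and let $\lambda':\mathrm{adom}(I)\to\mathbb{L}'$ be an arbitrary coloring of $I$ with a finite set of colors $\mathbb{L}'$. Then $\mathrm{cw}(I,\lambda')\le (n+1)\cdot|\mathbb{L}'|$.
   Context: An instance is a countable set of atoms with constants or nulls as terms (finitely many constants); $\mathrm{adom}(I)$ is its set of terms. Cliquewidth: for a finite color set $\mathbb{L}$ and finite constant set $\mathrm{Cnst}$, a well-decorated tree labels each node $s\in\{0,1\}^*$ of the infinite binary tree by exactly one of $c_k$ ($c\in\mathrm{Cnst}\cup\{*\}$, $k\in\mathbb{L}$), $\mathrm{Add}_{R,\vec k}$ ($\vec k\in\mathbb{L}^{\mathrm{ar}(R)}$), $\mathrm{Recolor}_{k\to k'}$, $\oplus$, $\mathrm{Void}$, with: each constant decorated at most once; $\mathrm{Add}$/$\mathrm{Recolor}$ nodes have non-$\mathrm{Void}$ left child and $\mathrm{Void}$ right child; $\oplus$ nodes have two non-$\mathrm{Void}$ children; $\mathrm{Void}$ and $c_k$ nodes have $\mathrm{Void}$ children. Node $s$ represents the elements introduced in its subtree ($*_k$ introduces the node itself as a null, $c_k$ the constant $c$), each colored by its introduction color as modified by the $\mathrm{Recolor}_{k\to k'}$ nodes (recolor every $k$-colored element to $k'$) on the path up to $s$; $\oplus$ is disjoint union; an $\mathrm{Add}_{R,\vec k}$ node adds $R(\vec e)$ for all tuples $\vec e$ of its elements with colors $\vec k$. The tree represents the colored instance consisting of all added atoms (plus $\top$-atoms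 for all elements) with the root's coloring. For a colored instance $(I,\lambda)$, $\mathrm{cw}(I,\lambda)$ is the least $|\mathbb{L}|$ such that $(I,\lambda)$ is isomorphic (as a colored instance, up to renaming colors) to a colored instance represented by an $(\mathbb{L},\mathrm{Cnst},\Sigma)$-well-decorated tree ($\infty$ if none); $\mathrm{cw}(I)=\min_\lambda \mathrm{cw}(I,\lambda)$. -}

module Defs where

open import Data.Nat using (ℕ; _≤_)
open import Data.Fin using (Fin; _≟_)
open import Data.Bool using (Bool; true; false; if_then_else_)
open import Data.List using (List; []; _∷_; _++_; [_])
open import Data.List.Membership.Propositional using (_∈_)
open import Data.Sum using (_⊎_; inj₁; inj₂)
open import Data.Product using (Σ; ∃; ∃-syntax; _×_)
open import Data.Unit using (⊤)
open import Data.Empty using (⊥)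
open import Relation.Nullary using (¬_)
open import Relation.Nullary.Decidable using (⌊_⌋)
open import Relation.Binary.PropositionalEquality using (_≡_)

-- A finite signature: finitely many relation symbols, each with an arity.
-- (The special unary symbol ⊤ is treated separately, see Instance.)
record Signature : Set where
  field
    nRel : ℕ
    ar   : Fin nRel → ℕ
open Signature public

Const : Set
Const = ℕ

Null : Set
Null = ℕ

Term : Set
Term = Const ⊎ Null

record Instance (Σ' : Signature) : Set₁ where
  field
    top : Term → Set
    rel : (R : Fin (nRel Σ')) → (Fin (ar Σ' R) → Term) → Set
open Instance public

adom : ∀ {Σ'} → Instance Σ' → Term → Set
adom {Σ'} I t = top I t ⊎ (∃[ R ] ∃[ tup ] (rel I R tup × ∃[ i ] tup i ≡ t))

FinitelyManyConstants : ∀ {Σ'} → Instance Σ' → Set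
FinitelyManyConstants I = ∃[ Cs ] (∀ (c : Const) → adom I (inj₁ c) → c ∈ Cs)

-- Labels with colour set Fin k (constants from Const; finiteness of the
-- used constant set is imposed in WellDecorated).
data Label (Σ' : Signature) (k : ℕ) : Set where
  cnst    : Const → Fin k → Label Σ' k
  star    : Fin k → Label Σ' k
  add     : (R : Fin (nRel Σ')) → (Fin (ar Σ' R) → Fin k) → Label Σ' k
  recolor : Fin k → Fin k → Label Σ' k
  oplus   : Label Σ' k
  void    : Label Σ' k

-- nodes of the infinite binary tree: words over {0,1} = {false,true};
-- the children of s are s ++ [ false ] (left) and s ++ [ true ] (right).
Node : Set
Node = List Bool

Tree : Signature → ℕ → Set
Tree Σ' k = Node → Label Σ' k

IsVoid : ∀ {Σ' k} → Label Σ' k → Set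
IsVoid void = ⊤
IsVoid _    = ⊥

WDNode : ∀ {Σ' k} → Label Σ' k → Label Σ' k → Label Σ' k → Set
WDNode (cnst _ _)    l r = IsVoid l × IsVoid r
WDNode (star _)      l r = IsVoid l × IsVoid r
WDNode (add _ _)     l r = ¬ IsVoid l × IsVoid r
WDNode (recolor _ _) l r = ¬ IsVoid l × IsVoid r
WDNode oplus         l r = ¬ IsVoid l × ¬ IsVoid r
WDNode void          l r = IsVoid l × IsVoid r

record WellDecorated {Σ' : Signature} {k : ℕ} (T : Tree Σ' k) : Set where
  field
    local      : ∀ s → WDNode (T s) (T (s ++ [ false ])) (T (s ++ [ true ]))
    constOnce  : ∀ s t c κ κ' → T s ≡ cnst c κ → T t ≡ cnst c κ' → s ≡ t
    finiteCnst : ∃[ Cs ] (∀ s c κ → T s ≡ cnst c κ → c ∈ Cs)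

step : ∀ {Σ' k} → Label Σ' k → Fin k → Fin k
step (recolor a b) c = if ⌊ c ≟ a ⌋ then b else c
step _             c = c

-- colour, as seen at node s, of an element introduced at node s ++ d
-- with colour κ
colourAt : ∀ {Σ' k} → Tree Σ' k → Node → List Bool → Fin k → Fin k
colourAt T s []      κ = κ
colourAt T s (b ∷ d) κ = step (T s) (colourAt T (s ++ [ b ]) d κ)

-- elements of the represented instance: constants, or nodes (as nulls)
Elem : Set
Elem = Const ⊎ Node

data HasElem {Σ' : Signature} {k : ℕ} (T : Tree Σ' k) (s : Node) : Elem → Fin k → Set where
  nul : ∀ d κ → T (s ++ d) ≡ star κ → HasElem T s (inj₂ (s ++ d)) (colourAt T s d κ)
  cst : ∀ d c κ → T (s ++ d) ≡ cnst c κ → HasElem T s (inj₁ c) (colourAt T s d κ)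

Added : ∀ {Σ' k} → Tree Σ' k → (R : Fin (nRel Σ')) → (Fin (ar Σ' R) → Elem) → Set
Added {Σ'} {k} T R tup =
  ∃[ s ] ∃[ ks ] (T s ≡ add R ks × (∀ i → HasElem T s (tup i) (ks i)))

-- elements of the represented instance (they carry the ⊤-atoms)
TreeElem : ∀ {Σ' k} → Tree Σ' k → Elem → Set
TreeElem T e = ∃[ κ ] HasElem T [] e κ

record ColIso {Σ' : Signature} {m k : ℕ} (I : Instance Σ') (λ' : Term → Fin m)
              (T : Tree Σ' k) : Set where
  field
    f : Term → Elem
    g : Elem → Term
    f-dom  : ∀ t → adom I t → TreeElem T (f t)
    g-dom  : ∀ e → TreeElem T e → adom I (g e)
    gf     : ∀ t → adom I t → g (f t) ≡ t
    fg     : ∀ e → TreeElem T e → f (g e) ≡ e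
    f-cnst : ∀ c → adom I (inj₁ c) → f (inj₁ c) ≡ inj₁ c
    g-cnst : ∀ c → TreeElem T (inj₁ c) → g (inj₁ c) ≡ inj₁ c
    top-f  : ∀ t → top I t → TreeElem T (f t)
    top-g  : ∀ e → TreeElem T e → top I (g e)
    rel-f  : ∀ R tup → rel I R tup → Added T R (λ i → f (tup i))
    rel-g  : ∀ R tup → Added T R tup → rel I R (λ i → g (tup i))
    -- colourings agree up to renaming of colours
    colour : ∀ t t' κ κ' → adom I t → adom I t' →
             HasElem T [] (f t) κ → HasElem T [] (f t') κ' →
             (λ' t ≡ λ' t' → κ ≡ κ') × (κ ≡ κ' → λ' t ≡ λ' t')

Representable : ∀ {Σ' m} → Instance Σ' → (Term → Fin m) → ℕ → Set
Representable {Σ'} I λ' k =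
  ∃[ T ] (WellDecorated {Σ'} {k} T × ColIso I λ' T)

cwCol≤ : ∀ {Σ' m} → Instance Σ' → (Term → Fin m) → ℕ → Set
cwCol≤ I λ' M = ∃[ k ] (k ≤ M × Representable I λ' k)

cw≡ : ∀ {Σ'} → Instance Σ' → ℕ → Set
cw≡ I n =
  (∃[ m ] ∃[ λ' ] Representable {m = m} I λ' n) ×
  (∀ m (λ' : Term → Fin m) k → Representable I λ' k → n ≤ k)

{-# OPTIONS --safe #-}
-- Take a tree for I with n colours and read the colours of a new tree as pairs (a, c) with
-- a ∈ Fin (1 + n) and c a colour of λ'; an element introduced with old colour κ gets the
-- pair (1 + κ, c) where c is its λ'-colour. Above every old node insert a chain of unary
-- nodes acting on the first component only: Recolor_{a→a'} becomes the recolourings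
-- (1 + a, c) → (1 + a', c) for all c, and Add_{R,k⃗} becomes the Adds for all pairs
-- (1 + k⃗, c⃗). The second component never changes, so the first one follows the old
-- colouring, exactly the old atoms are added, and the old isomorphism carries over along
-- the relocation of nodes. Finally every (a, c) is recoloured to (0, c) at the root, which
-- leaves the colouring λ' on (n + 1) · m colours.
module Submission where

open import Defs
open import Data.Nat using (ℕ; suc; _*_)
open import Data.Fin using (Fin)

open import Data.Nat using (zero; _+_; _^_)
open import Data.Nat.Properties using (≤-refl)
open import Data.Fin using (zero; suc; combine; remQuot; finToFun; funToFin; _≟_)
open import Data.Fin.Properties
  using (remQuot-combine; combine-injectiveˡ; combine-injectiveʳ; suc-injective; finToFun-funToFin)
open import Data.Bool using (Bool; true; false)
open import Data.List using (List; []; _∷_; _++_; [_]; map; length; replicate; allFin)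
open import Data.List.Properties using (++-assoc; ++-identityʳ; length-++; ∷-injective)
open import Data.List.Membership.Propositional using (_∈_)
open import Data.List.Membership.Propositional.Properties
  using (∈-allFin; ∈-map⁺; ∈-map⁻; ∈-∃++; ∈-++⁺ʳ)
open import Data.List.Relation.Unary.Any using (here; there)
open import Data.Sum using (_⊎_; inj₁; inj₂)
open import Data.Product using (∃-syntax; _×_; _,_; proj₁; proj₂; uncurry)
open import Data.Unit using (tt)
open import Data.Empty using (⊥-elim)
open import Function using (_∘_)
open import Relation.Nullary using (¬_; yes; no; contradiction)
open import Relation.Binary.PropositionalEquality
  using (_≡_; _≢_; refl; sym; trans; cong; subst; module ≡-Reasoning)

module Trees (Σ' : Signature) where

  LocallyWD : ∀ {k} → (Node → Label Σ' k) → Set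
  LocallyWD F = ∀ u → WDNode (F u) (F (u ++ [ false ])) (F (u ++ [ true ]))

  child : {A : Set} → (Node → A) → Bool → Node → A
  child F b w = F (b ∷ w)

  subtree : {A : Set} → (Node → A) → Node → Node → A
  subtree F s w = F (s ++ w)

  subtree-root : {A : Set} (F : Node → A) (s : Node) → subtree F s [] ≡ F s
  subtree-root F s = cong F (++-identityʳ s)

  step-recolor-hit : ∀ {k} (a b c : Fin k) → c ≡ a → step {Σ'} (recolor a b) c ≡ b
  step-recolor-hit a b c c≡a with c ≟ a
  ... | yes _   = refl
  ... | no c≢a = contradiction c≡a c≢a

  step-recolor-miss : ∀ {k} (a b c : Fin k) → c ≢ a → step {Σ'} (recolor a b) c ≡ c
  step-recolor-miss a b c c≢a with c ≟ a
  ... | yes c≡a = contradiction c≡a c≢a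
  ... | no _    = refl

  step-recolor-self : ∀ {k} (a c : Fin k) → step {Σ'} (recolor a a) c ≡ c
  step-recolor-self a c with c ≟ a
  ... | yes c≡a = sym c≡a
  ... | no _    = refl

  step-recolor-idem : ∀ {k} (a b c : Fin k) →
                      step {Σ'} (recolor a b) (step {Σ'} (recolor a b) c) ≡ step {Σ'} (recolor a b) c
  step-recolor-idem a b c with c ≟ a
  ... | yes _ with b ≟ a
  ...   | yes _ = refl
  ...   | no _  = refl
  step-recolor-idem a b c | no c≢a = step-recolor-miss a b c c≢a

  void-children : ∀ {k} {ℓ l r : Label Σ' k} → WDNode ℓ l r → IsVoid ℓ → IsVoid l × IsVoid r
  void-children {ℓ = void} wd _ = wd

  shift : Bool → Elem → Elem
  shift b (inj₁ c) = inj₁ c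
  shift b (inj₂ d) = inj₂ (b ∷ d)

  prefix : Node → Elem → Elem
  prefix u (inj₁ c) = inj₁ c
  prefix u (inj₂ d) = inj₂ (u ++ d)

  prefix-[] : ∀ e → prefix [] e ≡ e
  prefix-[] (inj₁ c) = refl
  prefix-[] (inj₂ d) = refl

  shift-prefix : ∀ b u e → shift b (prefix u e) ≡ prefix (b ∷ u) e
  shift-prefix b u (inj₁ c) = refl
  shift-prefix b u (inj₂ d) = refl

  prefix-∷ʳ : ∀ s b e → prefix (s ++ [ b ]) e ≡ prefix s (shift b e)
  prefix-∷ʳ s b (inj₁ c) = refl
  prefix-∷ʳ s b (inj₂ d) = cong inj₂ (++-assoc s [ b ] d)

  -- HasElem F [] e κ, by recursion on the tree instead of on node addresses.
  data Rep {k : ℕ} : (Node → Label Σ' k) → Elem → Fin k → Set where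
    star-root : ∀ {F κ}   → F [] ≡ star κ   → Rep F (inj₂ []) κ
    cnst-root : ∀ {F c κ} → F [] ≡ cnst c κ → Rep F (inj₁ c) κ
    below     : ∀ {F e κ} b → Rep (child F b) e κ → Rep F (shift b e) (step (F []) κ)

  module _ {k : ℕ} where

    castElem : ∀ {F : Node → Label Σ' k} {e e' κ} → e ≡ e' → Rep F e κ → Rep F e' κ
    castElem refl r = r

    castColour : ∀ {F : Node → Label Σ' k} {e κ κ'} → κ ≡ κ' → Rep F e κ → Rep F e κ'
    castColour refl r = r

    Rep-cong : ∀ {F G : Node → Label Σ' k} {e κ} → (∀ w → F w ≡ G w) → Rep F e κ → Rep G e κ
    Rep-cong F≗G (star-root eq) = star-root (trans (sym (F≗G [])) eq)
    Rep-cong F≗G (cnst-root eq) = cnst-root (trans (sym (F≗G [])) eq)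
    Rep-cong F≗G (below {κ = κ} b r) =
      castColour (cong (λ ℓ → step ℓ κ) (sym (F≗G []))) (below b (Rep-cong (λ w → F≗G (b ∷ w)) r))

    Rep⇒nonVoid : ∀ {F : Node → Label Σ' k} {e κ} → LocallyWD F → Rep F e κ → ¬ IsVoid (F [])
    Rep⇒nonVoid wd (star-root eq) v = subst IsVoid eq v
    Rep⇒nonVoid wd (cnst-root eq) v = subst IsVoid eq v
    Rep⇒nonVoid wd (below false r) v =
      Rep⇒nonVoid (λ u → wd (false ∷ u)) r (proj₁ (void-children (wd []) v))
    Rep⇒nonVoid wd (below true r) v =
      Rep⇒nonVoid (λ u → wd (true ∷ u)) r (proj₂ (void-children (wd []) v))

    ¬Rep-void : ∀ {e κ} → ¬ Rep (λ _ → void) e κ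
    ¬Rep-void r = Rep⇒nonVoid (λ _ → tt , tt) r tt

    castHasElem : ∀ {T : Tree Σ' k} {s e e' κ κ'} → e ≡ e' → κ ≡ κ' →
                  HasElem T s e κ → HasElem T s e' κ'
    castHasElem refl refl h = h

    HasElem-parent : ∀ (T : Tree Σ' k) s b {e κ} → HasElem T (s ++ [ b ]) e κ → HasElem T s e (step (T s) κ)
    HasElem-parent T s b (nul d κ eq) =
      castHasElem (cong inj₂ (sym (++-assoc s [ b ] d))) refl
        (nul (b ∷ d) κ (trans (cong T (sym (++-assoc s [ b ] d))) eq))
    HasElem-parent T s b (cst d c κ eq) = cst (b ∷ d) c κ (trans (cong T (sym (++-assoc s [ b ] d))) eq)

    private
      subtree-∷ʳ : ∀ (T : Tree Σ' k) s b w → subtree T (s ++ [ b ]) w ≡ child (subtree T s) b w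
      subtree-∷ʳ T s b w = cong T (++-assoc s [ b ] w)

      step-subtree-root : ∀ (T : Tree Σ' k) s κ → step (subtree T s []) κ ≡ step (T s) κ
      step-subtree-root T s κ = cong (λ ℓ → step ℓ κ) (cong T (++-identityʳ s))

    star→Rep : ∀ (T : Tree Σ' k) s d κ → T (s ++ d) ≡ star κ →
               Rep (subtree T s) (inj₂ d) (colourAt T s d κ)
    star→Rep T s []      κ eq = star-root eq
    star→Rep T s (b ∷ d) κ eq =
      castColour (step-subtree-root T s _)
        (below b (Rep-cong (subtree-∷ʳ T s b)
          (star→Rep T (s ++ [ b ]) d κ (trans (cong T (++-assoc s [ b ] d)) eq))))

    cnst→Rep : ∀ (T : Tree Σ' k) s d c κ → T (s ++ d) ≡ cnst c κ →
               Rep (subtree T s) (inj₁ c) (colourAt T s d κ)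
    cnst→Rep T s []      c κ eq = cnst-root eq
    cnst→Rep T s (b ∷ d) c κ eq =
      castColour (step-subtree-root T s _)
        (below b (Rep-cong (subtree-∷ʳ T s b)
          (cnst→Rep T (s ++ [ b ]) d c κ (trans (cong T (++-assoc s [ b ] d)) eq))))

    HasElem→Rep : ∀ (T : Tree Σ' k) s {e κ} → HasElem T s e κ →
                  ∃[ e' ] Rep (subtree T s) e' κ × e ≡ prefix s e'
    HasElem→Rep T s (nul d κ eq)   = inj₂ d , star→Rep T s d κ eq , refl
    HasElem→Rep T s (cst d c κ eq) = inj₁ c , cnst→Rep T s d c κ eq , refl

    Rep→HasElem : ∀ (T : Tree Σ' k) {F e κ} s → (∀ w → F w ≡ T (s ++ w)) →
                  Rep F e κ → HasElem T s (prefix s e) κ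
    Rep→HasElem T s F≗ (star-root {κ = κ} eq)        = nul [] κ (trans (sym (F≗ [])) eq)
    Rep→HasElem T s F≗ (cnst-root {c = c} {κ = κ} eq) = cst [] c κ (trans (sym (F≗ [])) eq)
    Rep→HasElem T s F≗ (below {e = e} {κ = κ} b r) =
      castHasElem (prefix-∷ʳ s b e) (cong (λ ℓ → step ℓ κ) (sym (trans (F≗ []) (cong T (++-identityʳ s)))))
        (HasElem-parent T s b
          (Rep→HasElem T (s ++ [ b ]) (λ w → trans (F≗ (b ∷ w)) (cong T (sym (++-assoc s [ b ] w)))) r))

    HasElem[]→Rep : ∀ (T : Tree Σ' k) {e κ} → HasElem T [] e κ → Rep T e κ
    HasElem[]→Rep T h with HasElem→Rep T [] h
    ... | e' , r , refl = castElem (sym (prefix-[] e')) r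

    Rep→HasElem[] : ∀ (T : Tree Σ' k) {e κ} → Rep T e κ → HasElem T [] e κ
    Rep→HasElem[] T {e} r = castHasElem (prefix-[] e) refl (Rep→HasElem T [] (λ _ → refl) r)

module Gadgets (Σ' : Signature) (k : ℕ) where
  open Trees Σ'

  data Unary : Set where
    recolor : Fin k → Fin k → Unary
    add     : (R : Fin (nRel Σ')) → (Fin (ar Σ' R) → Fin k) → Unary

  label : Unary → Label Σ' k
  label (recolor a b) = recolor a b
  label (add R ks)    = add R ks

  effect : List Unary → Fin k → Fin k
  effect []       z = z
  effect (u ∷ us) z = step (label u) (effect us z)

  effect-++ : ∀ us vs z → effect (us ++ vs) z ≡ effect us (effect vs z)
  effect-++ []       vs z = refl
  effect-++ (u ∷ us) vs z = cong (step (label u)) (effect-++ us vs z)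

  adds : (R : Fin (nRel Σ')) → List (Fin (ar Σ' R) → Fin k) → List Unary
  adds R = map (add R)

  effect-adds : ∀ R kss z → effect (adds R kss) z ≡ z
  effect-adds R []        z = refl
  effect-adds R (_ ∷ kss) z = effect-adds R kss z

  effect-adds-suffix : ∀ R kss ys zs → adds R kss ≡ ys ++ zs → ∀ z → effect zs z ≡ z
  effect-adds-suffix R kss       []       zs eq z = subst (λ us → effect us z ≡ z) eq (effect-adds R kss z)
  effect-adds-suffix R []        (_ ∷ ys) zs ()
  effect-adds-suffix R (_ ∷ kss) (_ ∷ ys) zs eq = effect-adds-suffix R kss ys zs (proj₂ (∷-injective eq))

  recolourings : (Fin k → Fin k) → List (Fin k) → List Unary
  recolourings ρ = map (λ z → recolor z (ρ z))

  split-after-recolourings : ∀ ρ zs vs ys ws R ks → recolourings ρ zs ++ vs ≡ ys ++ add R ks ∷ ws →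
                             ∃[ ys' ] ys ≡ recolourings ρ zs ++ ys' × vs ≡ ys' ++ add R ks ∷ ws
  split-after-recolourings ρ []       vs ys       ws R ks eq = ys , refl , eq
  split-after-recolourings ρ (z ∷ zs) vs []       ws R ks eq with ∷-injective eq
  ... | () , _
  split-after-recolourings ρ (z ∷ zs) vs (y ∷ ys) ws R ks eq with ∷-injective eq
  ... | refl , eq' with split-after-recolourings ρ zs vs ys ws R ks eq'
  ...   | ys' , refl , vs≡ = ys' , refl , vs≡

  -- Recolouring each z to ρ z in turn realises an idempotent ρ: once an element
  -- has reached ρ w, no later recolouring moves it.
  module _ (ρ : Fin k → Fin k) (ρ-idem : ∀ z → ρ (ρ z) ≡ ρ z) where

    private
      recolour-image : ∀ z w → step {Σ'} (recolor z (ρ z)) (ρ w) ≡ ρ w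
      recolour-image z w with ρ w ≟ z
      ... | yes ρw≡z = trans (cong ρ (sym ρw≡z)) (ρ-idem w)
      ... | no _     = refl

      recolour-any : ∀ z w → step {Σ'} (recolor z (ρ z)) w ≡ w ⊎ step {Σ'} (recolor z (ρ z)) w ≡ ρ w
      recolour-any z w with w ≟ z
      ... | yes w≡z = inj₂ (cong ρ (sym w≡z))
      ... | no _    = inj₁ refl

    effect-recolourings : ∀ zs w → effect (recolourings ρ zs) w ≡ w ⊎ effect (recolourings ρ zs) w ≡ ρ w
    effect-recolourings []       w = inj₁ refl
    effect-recolourings (z ∷ zs) w with effect-recolourings zs w
    ... | inj₁ eq rewrite eq = recolour-any z w
    ... | inj₂ eq rewrite eq = inj₂ (recolour-image z w)

    effect-recolourings-∈ : ∀ zs w → w ∈ zs → effect (recolourings ρ zs) w ≡ ρ w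
    effect-recolourings-∈ (z ∷ zs) w (here refl) with effect-recolourings zs w
    ... | inj₁ eq rewrite eq = step-recolor-hit w (ρ w) w refl
    ... | inj₂ eq rewrite eq = recolour-image w w
    effect-recolourings-∈ (z ∷ zs) w (there w∈zs) rewrite effect-recolourings-∈ zs w w∈zs = recolour-image z w

    effect-recolourings-allFin : ∀ w → effect (recolourings ρ (allFin k)) w ≡ ρ w
    effect-recolourings-allFin w = effect-recolourings-∈ (allFin k) w (∈-allFin w)

module Layers (a m : ℕ) where

  onLayer : (Fin a → Fin a) → Fin (a * m) → Fin (a * m)
  onLayer ψ z = uncurry (λ x c → combine (ψ x) c) (remQuot {a} m z)

  onLayer-combine : ∀ ψ x c → onLayer ψ (combine x c) ≡ combine (ψ x) c
  onLayer-combine ψ x c = cong (uncurry (λ x c → combine (ψ x) c)) (remQuot-combine {a} {m} x c)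

  onLayer-idem : ∀ ψ → (∀ x → ψ (ψ x) ≡ ψ x) → ∀ z → onLayer ψ (onLayer ψ z) ≡ onLayer ψ z
  onLayer-idem ψ ψ-idem z =
    trans (onLayer-combine ψ _ _) (cong (λ x → combine x (proj₂ (remQuot {a} m z))) (ψ-idem _))

-- A colour of the new tree is a pair (layer, c) with c ∈ Fin m: layer 1 + x carries the
-- old colour x, and layer 0 is only reached by the final retiring at the root.
module Expansion (Σ' : Signature) (n m : ℕ) (constColour : Const → Fin m) where
  open Trees Σ'
  open Layers (suc n) m

  K : ℕ
  K = suc n * m

  open Gadgets Σ' K

  active : Fin n → Fin m → Fin K
  active x c = combine (suc x) c

  retired : Fin m → Fin K
  retired c = combine {suc n} zero c

  retire : Fin K → Fin K
  retire = onLayer (λ _ → zero)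

  liftRecolor : Fin n → Fin n → Fin (suc n) → Fin (suc n)
  liftRecolor a a' zero    = zero
  liftRecolor a a' (suc x) = suc (step {Σ'} (recolor a a') x)

  liftRecolor-idem : ∀ a a' x → liftRecolor a a' (liftRecolor a a' x) ≡ liftRecolor a a' x
  liftRecolor-idem a a' zero    = refl
  liftRecolor-idem a a' (suc x) = cong suc (step-recolor-idem a a' x)

  tuples : ∀ {r} → (Fin r → Fin n) → List (Fin r → Fin K)
  tuples {r} ks = map (λ j i → active (ks i) (finToFun {m} {r} j i)) (allFin (m ^ r))

  gadget : Label Σ' n → List Unary
  gadget (recolor a a') = recolourings (onLayer (liftRecolor a a')) (allFin K)
  gadget (add R ks)     = adds R (tuples ks)
  gadget _              = []

  -- Above a Void root there is nothing to retire, and a chain would not be well decorated.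
  retiredColours : Label Σ' n → List (Fin K)
  retiredColours void = []
  retiredColours _    = allFin K

  retiring : Label Σ' n → List Unary
  retiring ℓ = recolourings retire (retiredColours ℓ)

  retire-allFin : ∀ z → effect (recolourings retire (allFin K)) z ≡ retire z
  retire-allFin = effect-recolourings-allFin retire (onLayer-idem (λ _ → zero) (λ _ → refl))

  -- A unary node keeps only a no-op Recolor in its place: its gadget does the work.
  core : Label Σ' n → Fin m → Label Σ' K
  core (cnst c κ)    _ = cnst c (active κ (constColour c))
  core (star κ)      c = star (active κ c)
  core (add _ _)     c = recolor (retired c) (retired c)
  core (recolor _ _) c = recolor (retired c) (retired c)
  core oplus         _ = oplus
  core void          _ = void

  -- C d is the target colour of the null introduced at d.
  mutual
    expand : (Node → Label Σ' n) → (Node → Fin m) → Tree Σ' K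
    expand F C = chain F C (gadget (F [])) (core (F []) (C []))

    chain : (Node → Label Σ' n) → (Node → Fin m) → List Unary → Label Σ' K → Tree Σ' K
    chain F C []       ℓ w           = expandCore F C ℓ w
    chain F C (u ∷ us) ℓ []          = label u
    chain F C (u ∷ us) ℓ (false ∷ w) = chain F C us ℓ w
    chain F C (u ∷ us) ℓ (true ∷ w)  = void

    expandCore : (Node → Label Σ' n) → (Node → Fin m) → Label Σ' K → Tree Σ' K
    expandCore F C ℓ []      = ℓ
    expandCore F C ℓ (b ∷ w) = expand (child F b) (child C b) w

  lefts : ℕ → Node
  lefts k = replicate k false

  lefts-+ : ∀ a b → lefts (a + b) ≡ lefts a ++ lefts b
  lefts-+ zero    b = refl
  lefts-+ (suc a) b = cong (false ∷_) (lefts-+ a b)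

  lefts-length-++ : ∀ {A : Set} (xs ys : List A) →
                    lefts (length (xs ++ ys)) ≡ lefts (length xs) ++ lefts (length ys)
  lefts-length-++ xs ys = trans (cong lefts (length-++ xs)) (lefts-+ (length xs) (length ys))

  mutual
    position : (Node → Label Σ' n) → Node → Node
    position F d = lefts (length (gadget (F []))) ++ positionCore F d

    positionCore : (Node → Label Σ' n) → Node → Node
    positionCore F []      = []
    positionCore F (b ∷ d) = b ∷ position (child F b) d

  mutual
    unpositionCore : (Node → Label Σ' n) → Node → Node
    unpositionCore F []      = []
    unpositionCore F (b ∷ w) = b ∷ skipGadget (child F b) (length (gadget (F (b ∷ [])))) w

    skipGadget : (Node → Label Σ' n) → ℕ → Node → Node
    skipGadget F zero    w       = unpositionCore F w
    skipGadget F (suc k) []      = []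
    skipGadget F (suc k) (_ ∷ w) = skipGadget F k w

  skipGadget-lefts : ∀ F k u → skipGadget F k (lefts k ++ u) ≡ unpositionCore F u
  skipGadget-lefts F zero    u = refl
  skipGadget-lefts F (suc k) u = skipGadget-lefts F k u

  unposition-position : ∀ F q → unpositionCore F (positionCore F q) ≡ q
  unposition-position F []      = refl
  unposition-position F (b ∷ q) =
    cong (b ∷_) (trans (skipGadget-lefts (child F b) (length (gadget (F (b ∷ [])))) (positionCore (child F b) q))
                       (unposition-position (child F b) q))

  relocate : (Node → Label Σ' n) → Elem → Elem
  relocate F (inj₁ c) = inj₁ c
  relocate F (inj₂ d) = inj₂ (positionCore F d)

  relocate-shift : ∀ F b e →
    shift b (prefix (lefts (length (gadget (F (b ∷ []))))) (relocate (child F b) e)) ≡ relocate F (shift b e)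
  relocate-shift F b (inj₁ c) = refl
  relocate-shift F b (inj₂ d) = refl

  elemColour : (Node → Fin m) → Elem → Fin m
  elemColour C (inj₁ c) = constColour c
  elemColour C (inj₂ d) = C d

  elemColour-shift : ∀ C b e → elemColour C (shift b e) ≡ elemColour (child C b) e
  elemColour-shift C b (inj₁ c) = refl
  elemColour-shift C b (inj₂ d) = refl

  pairColour : (Node → Fin m) → Elem → Fin n → Fin K
  pairColour C e x = active x (elemColour C e)

  step-core : ∀ ℓ c z → step (core ℓ c) z ≡ z
  step-core (cnst _ _)    c z = refl
  step-core (star _)      c z = refl
  step-core (add _ _)     c z = step-recolor-self (retired c) z
  step-core (recolor _ _) c z = step-recolor-self (retired c) z
  step-core oplus         c z = refl
  step-core void          c z = refl

  effect-gadget : ∀ ℓ x c → effect (gadget ℓ) (active x c) ≡ active (step ℓ x) c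
  effect-gadget (recolor a a') x c =
    trans (effect-recolourings-allFin (onLayer (liftRecolor a a')) (onLayer-idem _ (liftRecolor-idem a a')) (active x c))
          (onLayer-combine (liftRecolor a a') (suc x) c)
  effect-gadget (add R ks)  x c = effect-adds R (tuples ks) (active x c)
  effect-gadget (cnst _ _)  x c = refl
  effect-gadget (star _)    x c = refl
  effect-gadget oplus       x c = refl
  effect-gadget void        x c = refl

  effect-add-suffix : ∀ ℓ R ks → ℓ ≡ add R ks →
                      ∀ ys zs → gadget ℓ ≡ ys ++ zs → ∀ z → effect zs z ≡ z
  effect-add-suffix _ R ks refl = effect-adds-suffix R (tuples ks)

  effect-retiring : ∀ ℓ → ¬ IsVoid ℓ → ∀ z → effect (retiring ℓ) z ≡ retire z
  effect-retiring void          nv = contradiction tt nv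
  effect-retiring (cnst _ _)    _  = retire-allFin
  effect-retiring (star _)      _  = retire-allFin
  effect-retiring (add _ _)     _  = retire-allFin
  effect-retiring (recolor _ _) _  = retire-allFin
  effect-retiring oplus         _  = retire-allFin

  core≡star : ∀ ℓ c κ' → core ℓ c ≡ star κ' → ∃[ κ ] ℓ ≡ star κ × κ' ≡ active κ c
  core≡star (star κ) c _ refl = κ , refl , refl

  core≡cnst : ∀ ℓ c d κ' → core ℓ c ≡ cnst d κ' →
              ∃[ κ ] ℓ ≡ cnst d κ × κ' ≡ active κ (constColour d)
  core≡cnst (cnst d κ) c _ _ refl = κ , refl , refl

  core≢add : ∀ ℓ c R ks → core ℓ c ≢ add R ks
  core≢add (cnst _ _)    c R ks ()
  core≢add (star _)      c R ks ()
  core≢add (add _ _)     c R ks ()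
  core≢add (recolor _ _) c R ks ()
  core≢add oplus         c R ks ()
  core≢add void          c R ks ()

  gadget-add-∋ : ∀ R ks (cs : Fin (ar Σ' R) → Fin m) →
                 add R (λ i → active (ks i) (finToFun {m} {ar Σ' R} (funToFin cs) i)) ∈ gadget (add R ks)
  gadget-add-∋ R ks cs = ∈-map⁺ (add R) (∈-map⁺ _ (∈-allFin (funToFin cs)))

  ∈-gadget-add : ∀ ℓ R ks' → add R ks' ∈ gadget ℓ →
                 ∃[ ks ] ∃[ j ] ℓ ≡ add R ks × ks' ≡ (λ i → active (ks i) (finToFun {m} {ar Σ' R} j i))
  ∈-gadget-add (recolor a a') R ks' u∈ with ∈-map⁻ _ u∈
  ... | _ , _ , ()
  ∈-gadget-add (add R₀ ks) R ks' u∈ with ∈-map⁻ (add R₀) u∈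
  ... | t , t∈ , refl with ∈-map⁻ _ t∈
  ...   | j , _ , refl = ks , j , refl , refl

  Rep-chain : ∀ {F C ℓ e z} us → Rep (expandCore F C ℓ) e z →
              Rep (chain F C us ℓ) (prefix (lefts (length us)) e) (effect us z)
  Rep-chain {e = e} []       r = castElem (sym (prefix-[] e)) r
  Rep-chain {e = e} (u ∷ us) r = castElem (shift-prefix false (lefts (length us)) e) (below false (Rep-chain us r))

  mutual
    Rep-expandCore : ∀ {F C e x} → Rep F e x →
      ∃[ z ] Rep (expandCore F C (core (F []) (C []))) (relocate F e) z × effect (gadget (F [])) z ≡ pairColour C e x
    Rep-expandCore {F} {C} (star-root {κ = κ} eq) =
      active κ (C []) , star-root (cong (λ ℓ → core ℓ (C [])) eq) ,
      trans (effect-gadget (F []) κ (C [])) (cong (λ ℓ → active (step ℓ κ) (C [])) eq)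
    Rep-expandCore {F} {C} (cnst-root {c = c} {κ = κ} eq) =
      active κ (constColour c) , cnst-root (cong (λ ℓ → core ℓ (C [])) eq) ,
      trans (effect-gadget (F []) κ (constColour c)) (cong (λ ℓ → active (step ℓ κ) (constColour c)) eq)
    Rep-expandCore {F} {C} (below {e = e} {κ = x} b r) =
      pairColour (child C b) e x ,
      castElem (relocate-shift F b e)
        (castColour (step-core (F []) (C []) _) (below b (Rep-chain⁺ {F = child F b} {C = child C b} [] r))) ,
      trans (effect-gadget (F []) x _) (cong (active (step (F []) x)) (sym (elemColour-shift C b e)))

    Rep-chain⁺ : ∀ {F C e x} us → Rep F e x →
      Rep (chain F C (us ++ gadget (F [])) (core (F []) (C [])))
          (prefix (lefts (length (us ++ gadget (F [])))) (relocate F e)) (effect us (pairColour C e x))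
    Rep-chain⁺ {F} {C} us r with Rep-expandCore {C = C} r
    ... | z , r' , z↦ =
      castColour (trans (effect-++ us (gadget (F [])) z) (cong (effect us) z↦)) (Rep-chain (us ++ gadget (F [])) r')

  record Preimage (F : Node → Label Σ' n) (C : Node → Fin m) (us : List Unary) (e : Elem) (y : Fin K) : Set where
    constructor preimage
    field
      old        : Elem
      oldColour  : Fin n
      coreColour : Fin K
      rep        : Rep F old oldColour
      elem≡      : e ≡ prefix (lefts (length us)) (relocate F old)
      colour≡    : y ≡ effect us coreColour
      gadget≡    : effect (gadget (F [])) coreColour ≡ pairColour C old oldColour

  Rep-chain⁻ : ∀ {F C e y} us → Rep (chain F C us (core (F []) (C []))) e y → Preimage F C us e y
  Rep-chain⁻ (recolor _ _ ∷ us) (star-root ())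
  Rep-chain⁻ (add _ _ ∷ us)     (star-root ())
  Rep-chain⁻ (recolor _ _ ∷ us) (cnst-root ())
  Rep-chain⁻ (add _ _ ∷ us)     (cnst-root ())
  Rep-chain⁻ (u ∷ us) (below true r) = ⊥-elim (¬Rep-void r)
  Rep-chain⁻ (u ∷ us) (below false r) with Rep-chain⁻ us r
  ... | preimage e₀ x z r₀ e≡ y≡ g≡ =
    preimage e₀ x z r₀ (trans (cong (shift false) e≡) (shift-prefix false _ _)) (cong (step (label u)) y≡) g≡
  Rep-chain⁻ {F} {C} [] (star-root {κ = κ'} eq) with core≡star (F []) (C []) κ' eq
  ... | κ , F≡ , κ'≡ =
    preimage (inj₂ []) κ κ' (star-root F≡) refl refl (trans (cong (λ ℓ → effect (gadget ℓ) κ') F≡) κ'≡)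
  Rep-chain⁻ {F} {C} [] (cnst-root {c = c} {κ = κ'} eq) with core≡cnst (F []) (C []) c κ' eq
  ... | κ , F≡ , κ'≡ =
    preimage (inj₁ c) κ κ' (cnst-root F≡) refl refl (trans (cong (λ ℓ → effect (gadget ℓ) κ') F≡) κ'≡)
  Rep-chain⁻ {F} {C} [] (below {κ = y} b r) with Rep-chain⁻ {F = child F b} {C = child C b} (gadget (F (b ∷ []))) r
  ... | preimage e₀ x z r₀ e≡ y≡ g≡ =
    preimage (shift b e₀) (step (F []) x) (step (core (F []) (C [])) y) (below b r₀)
      (trans (cong (shift b) e≡) (trans (relocate-shift F b e₀) (sym (prefix-[] _)))) refl
      (trans (cong (effect (gadget (F []))) (trans (step-core (F []) (C []) y) (trans y≡ g≡)))
             (trans (effect-gadget (F []) x _) (cong (active (step (F []) x)) (sym (elemColour-shift C b e₀)))))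

  chain-root-void : ∀ F C us ℓ → IsVoid (chain F C us (core ℓ (C [])) []) → IsVoid ℓ
  chain-root-void F C (recolor _ _ ∷ us) ℓ ()
  chain-root-void F C (add _ _ ∷ us)     ℓ ()
  chain-root-void F C [] void v = tt

  void-chain-root : ∀ F C ℓ → IsVoid ℓ → IsVoid (chain F C (gadget ℓ) (core ℓ (C [])) [])
  void-chain-root F C void v = tt

  core-local : ∀ ℓ c {l r : Label Σ' n} {l' r' : Label Σ' K} → WDNode ℓ l r →
               (IsVoid l' → IsVoid l) → (IsVoid l → IsVoid l') →
               (IsVoid r' → IsVoid r) → (IsVoid r → IsVoid r') → WDNode (core ℓ c) l' r'
  core-local (cnst _ _)    c (vl , vr) l'→l l→l' r'→r r→r' = l→l' vl , r→r' vr
  core-local (star _)      c (vl , vr) l'→l l→l' r'→r r→r' = l→l' vl , r→r' vr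
  core-local (add _ _)     c (vl , vr) l'→l l→l' r'→r r→r' = (λ v → vl (l'→l v)) , r→r' vr
  core-local (recolor _ _) c (vl , vr) l'→l l→l' r'→r r→r' = (λ v → vl (l'→l v)) , r→r' vr
  core-local oplus         c (vl , vr) l'→l l→l' r'→r r→r' = (λ v → vl (l'→l v)) , (λ v → vr (r'→r v))
  core-local void          c (vl , vr) l'→l l→l' r'→r r→r' = l→l' vl , r→r' vr

  gadget-empty-or-nonVoid : ∀ ℓ → gadget ℓ ≡ [] ⊎ ¬ IsVoid ℓ
  gadget-empty-or-nonVoid (add _ _)     = inj₂ (λ ())
  gadget-empty-or-nonVoid (recolor _ _) = inj₂ (λ ())
  gadget-empty-or-nonVoid (cnst _ _)    = inj₁ refl
  gadget-empty-or-nonVoid (star _)      = inj₁ refl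
  gadget-empty-or-nonVoid oplus         = inj₁ refl
  gadget-empty-or-nonVoid void          = inj₁ refl

  top-empty-or-nonVoid : ∀ ℓ → retiring ℓ ++ gadget ℓ ≡ [] ⊎ ¬ IsVoid ℓ
  top-empty-or-nonVoid void = inj₁ refl
  top-empty-or-nonVoid (cnst _ _)    = inj₂ (λ ())
  top-empty-or-nonVoid (star _)      = inj₂ (λ ())
  top-empty-or-nonVoid (add _ _)     = inj₂ (λ ())
  top-empty-or-nonVoid (recolor _ _) = inj₂ (λ ())
  top-empty-or-nonVoid oplus         = inj₂ (λ ())

  chain-local : ∀ F C → LocallyWD F → ∀ us → us ≡ [] ⊎ ¬ IsVoid (F []) →
                LocallyWD (chain F C us (core (F []) (C [])))
  chain-local F C wd (recolor _ _ ∷ us) (inj₁ ())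
  chain-local F C wd (add _ _ ∷ us)     (inj₁ ())
  chain-local F C wd (recolor _ _ ∷ us) (inj₂ nv) [] = (λ v → nv (chain-root-void F C us (F []) v)) , tt
  chain-local F C wd (add _ _ ∷ us)     (inj₂ nv) [] = (λ v → nv (chain-root-void F C us (F []) v)) , tt
  chain-local F C wd (u ∷ us) (inj₂ nv) (false ∷ w) = chain-local F C wd us (inj₂ nv) w
  chain-local F C wd (u ∷ us) (inj₂ nv) (true ∷ w)  = tt , tt
  chain-local F C wd [] _ [] =
    core-local (F []) (C []) (wd [])
      (chain-root-void (child F false) (child C false) (gadget (F (false ∷ []))) _)
      (void-chain-root (child F false) (child C false) _)
      (chain-root-void (child F true) (child C true) (gadget (F (true ∷ []))) _)
      (void-chain-root (child F true) (child C true) _)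
  chain-local F C wd [] _ (b ∷ w) =
    chain-local (child F b) (child C b) (λ u → wd (b ∷ u)) (gadget (F (b ∷ []))) (gadget-empty-or-nonVoid _) w

  chain-cnst : ∀ F C us w c κ → chain F C us (core (F []) (C [])) w ≡ cnst c κ →
               ∃[ d ] ∃[ κ₀ ] w ≡ lefts (length us) ++ positionCore F d × F d ≡ cnst c κ₀
  chain-cnst F C (recolor _ _ ∷ us) [] c κ ()
  chain-cnst F C (add _ _ ∷ us)     [] c κ ()
  chain-cnst F C (u ∷ us) (false ∷ w) c κ eq with chain-cnst F C us w c κ eq
  ... | d , κ₀ , refl , F≡ = d , κ₀ , refl , F≡
  chain-cnst F C (u ∷ us) (true ∷ w) c κ ()
  chain-cnst F C [] [] c κ eq with core≡cnst (F []) (C []) c κ eq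
  ... | κ₀ , F≡ , _ = [] , κ₀ , refl , F≡
  chain-cnst F C [] (b ∷ w) c κ eq with chain-cnst (child F b) (child C b) (gadget (F (b ∷ []))) w c κ eq
  ... | d , κ₀ , refl , F≡ = b ∷ d , κ₀ , refl , F≡

  gadgetAddr : (Node → Label Σ' n) → Node → Node
  gadgetAddr F []      = []
  gadgetAddr F (b ∷ s) = lefts (length (gadget (F []))) ++ b ∷ gadgetAddr (child F b) s

  AddPosition : (Node → Label Σ' n) → List Unary → Node →
                (R : Fin (nRel Σ')) → (Fin (ar Σ' R) → Fin K) → Set
  AddPosition F us w R ks =
    (∃[ ys ] ∃[ zs ] w ≡ lefts (length ys) × us ≡ ys ++ add R ks ∷ zs) ⊎
    (∃[ b ] ∃[ s ] ∃[ ys ] ∃[ zs ]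
       w ≡ lefts (length us) ++ b ∷ (gadgetAddr (child F b) s ++ lefts (length ys)) ×
       gadget (subtree (child F b) s []) ≡ ys ++ add R ks ∷ zs)

  chain-add : ∀ F C us w R ks → chain F C us (core (F []) (C [])) w ≡ add R ks → AddPosition F us w R ks
  chain-add F C (recolor _ _ ∷ us) [] R ks ()
  chain-add F C (add R ks ∷ us)    [] .R .ks refl = inj₁ ([] , us , refl , refl)
  chain-add F C (u ∷ us) (false ∷ w) R ks eq with chain-add F C us w R ks eq
  ... | inj₁ (ys , zs , refl , refl)        = inj₁ (u ∷ ys , zs , refl , refl)
  ... | inj₂ (b , s , ys , zs , refl , split) = inj₂ (b , s , ys , zs , refl , split)
  chain-add F C (u ∷ us) (true ∷ w) R ks ()
  chain-add F C [] [] R ks eq = contradiction eq (core≢add (F []) (C []) R ks)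
  chain-add F C [] (b ∷ w) R ks eq with chain-add (child F b) (child C b) (gadget (F (b ∷ []))) w R ks eq
  ... | inj₁ (ys , zs , refl , split) = inj₂ (b , [] , ys , zs , refl , split)
  ... | inj₂ (b' , s , ys , zs , refl , split) =
    inj₂ (b , b' ∷ s , ys , zs ,
          cong (b ∷_) (sym (++-assoc (lefts (length (gadget (F (b ∷ [])))))
                                     (b' ∷ gadgetAddr (child (child F b) b') s) (lefts (length ys)))) ,
          split)

  chain-lefts : ∀ F C us ℓ w → chain F C us ℓ (lefts (length us) ++ w) ≡ expandCore F C ℓ w
  chain-lefts F C []       ℓ w = refl
  chain-lefts F C (u ∷ us) ℓ w = chain-lefts F C us ℓ w

  chain-++-lefts : ∀ F C ys zs ℓ w → chain F C (ys ++ zs) ℓ (lefts (length ys) ++ w) ≡ chain F C zs ℓ w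
  chain-++-lefts F C []       zs ℓ w = refl
  chain-++-lefts F C (y ∷ ys) zs ℓ w = chain-++-lefts F C ys zs ℓ w

  expand-gadgetAddr : ∀ F C s w → expand F C (gadgetAddr F s ++ w) ≡ expand (subtree F s) (subtree C s) w
  expand-gadgetAddr F C []      w = refl
  expand-gadgetAddr F C (b ∷ s) w =
    trans (cong (expand F C) (++-assoc (lefts (length (gadget (F [])))) (b ∷ gadgetAddr (child F b) s) w))
      (trans (chain-lefts F C (gadget (F [])) (core (F []) (C [])) (b ∷ (gadgetAddr (child F b) s ++ w)))
             (expand-gadgetAddr (child F b) (child C b) s w))

  gadgetAddr-position : ∀ F s d → gadgetAddr F s ++ position (subtree F s) d ≡ position F (s ++ d)
  gadgetAddr-position F []      d = refl
  gadgetAddr-position F (b ∷ s) d =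
    trans (++-assoc (lefts (length (gadget (F [])))) (b ∷ gadgetAddr (child F b) s) (position (subtree (child F b) s) d))
          (cong (λ p → lefts (length (gadget (F []))) ++ (b ∷ p)) (gadgetAddr-position (child F b) s d))

module Recoloured (Σ' : Signature) (n m : ℕ) (I : Instance Σ') (λ' : Term → Fin m)
                  (T : Tree Σ' n) (T-wd : WellDecorated T)
                  {m₀ : ℕ} {λ₀ : Term → Fin m₀} (iso : ColIso I λ₀ T) where
  open Trees Σ'
  open ColIso iso
  open WellDecorated T-wd

  target : Elem → Fin m
  target e = λ' (g e)

  open Expansion Σ' n m (λ c → target (inj₁ c))
  open Gadgets Σ' K
  open Layers (suc n) m

  C₀ : Node → Fin m
  C₀ d = target (inj₂ d)

  topChain : List Unary
  topChain = retiring (T []) ++ gadget (T [])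

  T' : Tree Σ' K
  T' = chain T C₀ topChain (core (T []) (C₀ []))

  embed : Elem → Elem
  embed e = prefix (lefts (length topChain)) (relocate T e)

  unembed : Elem → Elem
  unembed (inj₁ c) = inj₁ c
  unembed (inj₂ w) = inj₂ (skipGadget T (length topChain) w)

  unembed-embed : ∀ e → unembed (embed e) ≡ e
  unembed-embed (inj₁ c) = refl
  unembed-embed (inj₂ q) =
    cong inj₂ (trans (skipGadget-lefts T (length topChain) (positionCore T q)) (unposition-position T q))

  elemColour-subtree : ∀ s e → elemColour (subtree C₀ s) e ≡ target (prefix s e)
  elemColour-subtree s (inj₁ c) = refl
  elemColour-subtree s (inj₂ d) = refl

  T'-wd : WellDecorated T'
  T'-wd = record
    { local      = chain-local T C₀ local topChain (top-empty-or-nonVoid (T []))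
    ; constOnce  = const-once
    ; finiteCnst = finite-cnst }
    where
      const-once : ∀ s t c κ κ' → T' s ≡ cnst c κ → T' t ≡ cnst c κ' → s ≡ t
      const-once s t c κ κ' s≡ t≡
        with chain-cnst T C₀ topChain s c κ s≡ | chain-cnst T C₀ topChain t c κ' t≡
      ... | d , κ₀ , refl , d≡ | d' , κ₀' , refl , d'≡ =
        cong (λ q → lefts (length topChain) ++ positionCore T q) (constOnce d d' c κ₀ κ₀' d≡ d'≡)
      finite-cnst : ∃[ Cs ] (∀ s c κ → T' s ≡ cnst c κ → c ∈ Cs)
      finite-cnst with finiteCnst
      ... | Cs , Cs-complete =
        Cs , λ s c κ s≡ → let d , κ₀ , _ , d≡ = chain-cnst T C₀ topChain s c κ s≡
                          in Cs-complete d c κ₀ d≡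

  record RootPreimage (e : Elem) (y : Fin K) : Set where
    constructor rootPreimage
    field
      old       : Elem
      oldColour : Fin n
      rep       : Rep T old oldColour
      elem≡     : e ≡ embed old
      colour≡   : y ≡ effect (retiring (T [])) (pairColour C₀ old oldColour)

  T'-preimage : ∀ {e y} → HasElem T' [] e y → RootPreimage e y
  T'-preimage h with Rep-chain⁻ topChain (HasElem[]→Rep T' h)
  ... | preimage e₀ x z r₀ e≡ y≡ g≡ =
    rootPreimage e₀ x r₀ e≡
      (trans y≡ (trans (effect-++ (retiring (T [])) (gadget (T [])) z) (cong (effect (retiring (T []))) g≡)))

  embed-TreeElem : ∀ {e} → TreeElem T e → TreeElem T' (embed e)
  embed-TreeElem (x , h) = _ , Rep→HasElem[] T' (Rep-chain⁺ (retiring (T [])) (HasElem[]→Rep T h))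

  unembed-TreeElem : ∀ {e} → TreeElem T' e → TreeElem T (unembed e) × e ≡ embed (unembed e)
  unembed-TreeElem (y , h) with T'-preimage h
  ... | rootPreimage e₀ x r₀ refl _ =
    subst (TreeElem T) (sym (unembed-embed e₀)) (x , Rep→HasElem[] T r₀) , cong embed (sym (unembed-embed e₀))

  root-colour : ∀ t κ → adom I t → HasElem T' [] (embed (f t)) κ → κ ≡ retired (λ' t)
  root-colour t κ t∈ h with T'-preimage h
  ... | rootPreimage e₀ x r₀ e≡ κ≡ = begin
    κ                                                  ≡⟨ κ≡ ⟩
    effect (retiring (T [])) (active x (elemColour C₀ e₀))
                                                       ≡⟨ effect-retiring (T []) (Rep⇒nonVoid local r₀) _ ⟩
    retire (active x (elemColour C₀ e₀))               ≡⟨ onLayer-combine (λ _ → zero) (suc x) _ ⟩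
    retired (elemColour C₀ e₀)                         ≡⟨ cong retired (elemColour-subtree [] e₀) ⟩
    retired (λ' (g (prefix [] e₀)))                    ≡⟨ cong (λ e → retired (λ' (g e))) (prefix-[] e₀) ⟩
    retired (λ' (g e₀))                                ≡⟨ cong (λ e → retired (λ' (g e))) f-t≡e₀ ⟨
    retired (λ' (g (f t)))                             ≡⟨ cong (retired ∘ λ') (gf t t∈) ⟩
    retired (λ' t)                                     ∎
    where
      open ≡-Reasoning
      f-t≡e₀ : f t ≡ e₀
      f-t≡e₀ = trans (sym (unembed-embed (f t))) (trans (cong unembed e≡) (unembed-embed e₀))

  itemAddr : Node → List Unary → Node
  itemAddr s ys = lefts (length (retiring (T []))) ++ (gadgetAddr T s ++ lefts (length ys))

  T'-itemAddr : ∀ s ys u zs → gadget (subtree T s []) ≡ ys ++ u ∷ zs → ∀ v →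
                T' (itemAddr s ys ++ v) ≡
                chain (subtree T s) (subtree C₀ s) (u ∷ zs) (core (subtree T s []) (subtree C₀ s [])) v
  T'-itemAddr s ys u zs split v = begin
    T' ((A ++ (B ++ L)) ++ v)
      ≡⟨ cong T' (trans (++-assoc A (B ++ L) v) (cong (A ++_) (++-assoc B L v))) ⟩
    T' (A ++ (B ++ (L ++ v)))
      ≡⟨ chain-++-lefts T C₀ (retiring (T [])) (gadget (T [])) _ (B ++ (L ++ v)) ⟩
    expand T C₀ (B ++ (L ++ v))                  ≡⟨ expand-gadgetAddr T C₀ s (L ++ v) ⟩
    chain F C (gadget (F [])) cr (L ++ v)        ≡⟨ cong (λ us → chain F C us cr (L ++ v)) split ⟩
    chain F C (ys ++ u ∷ zs) cr (L ++ v)         ≡⟨ chain-++-lefts F C ys (u ∷ zs) cr v ⟩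
    chain F C (u ∷ zs) cr v                      ∎
    where
      open ≡-Reasoning
      A = lefts (length (retiring (T [])))
      B = gadgetAddr T s
      L = lefts (length ys)
      F = subtree T s
      C = subtree C₀ s
      cr = core (F []) (C [])

  embed-itemAddr : ∀ s ys u zs → gadget (subtree T s []) ≡ ys ++ u ∷ zs → ∀ e →
                   prefix (itemAddr s ys) (prefix (lefts (length (u ∷ zs))) (relocate (subtree T s) e)) ≡
                   embed (prefix s e)
  embed-itemAddr s ys u zs split (inj₁ c) = refl
  embed-itemAddr s ys u zs split (inj₂ d) = cong inj₂ (begin
    (A ++ (B ++ L)) ++ (D ++ c)
      ≡⟨ trans (++-assoc A (B ++ L) (D ++ c)) (cong (A ++_) (++-assoc B L (D ++ c))) ⟩
    A ++ (B ++ (L ++ (D ++ c)))           ≡⟨ cong (λ p → A ++ (B ++ p)) (sym (++-assoc L D c)) ⟩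
    A ++ (B ++ ((L ++ D) ++ c))           ≡⟨ cong (λ p → A ++ (B ++ (p ++ c))) L++D≡ ⟩
    A ++ (B ++ position F d)              ≡⟨ cong (A ++_) (gadgetAddr-position T s d) ⟩
    A ++ (G ++ positionCore T (s ++ d))   ≡⟨ ++-assoc A G _ ⟨
    (A ++ G) ++ positionCore T (s ++ d)
      ≡⟨ cong (_++ positionCore T (s ++ d)) (lefts-length-++ (retiring (T [])) (gadget (T []))) ⟨
    lefts (length topChain) ++ positionCore T (s ++ d) ∎)
    where
      open ≡-Reasoning
      A = lefts (length (retiring (T [])))
      B = gadgetAddr T s
      G = lefts (length (gadget (T [])))
      L = lefts (length ys)
      D = lefts (length (u ∷ zs))
      F = subtree T s
      c = positionCore F d
      L++D≡ : L ++ D ≡ lefts (length (gadget (F [])))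
      L++D≡ = trans (sym (lefts-length-++ ys (u ∷ zs))) (cong (lefts ∘ length) (sym split))

  T'-add-position : ∀ w R ks → T' w ≡ add R ks →
                    ∃[ s ] ∃[ ys ] ∃[ zs ] w ≡ itemAddr s ys × gadget (subtree T s []) ≡ ys ++ add R ks ∷ zs
  T'-add-position w R ks w≡ with chain-add T C₀ topChain w R ks w≡
  ... | inj₁ (ys , zs , refl , split)
        with split-after-recolourings retire (retiredColours (T [])) (gadget (T [])) ys zs R ks split
  ...   | ys' , refl , split' = [] , ys' , zs , lefts-length-++ (retiring (T [])) ys' , split'
  T'-add-position w R ks w≡ | inj₂ (b , s , ys , zs , refl , split) = b ∷ s , ys , zs , w≡' , split
    where
      open ≡-Reasoning
      A = lefts (length (retiring (T [])))
      Bo = lefts (length (gadget (T [])))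
      G = gadgetAddr (child T b) s
      L = lefts (length ys)
      w≡' : lefts (length topChain) ++ b ∷ (G ++ L) ≡ A ++ ((Bo ++ b ∷ G) ++ L)
      w≡' = begin
        lefts (length topChain) ++ b ∷ (G ++ L)
          ≡⟨ cong (_++ b ∷ (G ++ L)) (lefts-length-++ (retiring (T [])) (gadget (T []))) ⟩
        (A ++ Bo) ++ b ∷ (G ++ L)              ≡⟨ ++-assoc A Bo _ ⟩
        A ++ (Bo ++ b ∷ (G ++ L))              ≡⟨ cong (A ++_) (++-assoc Bo (b ∷ G) L) ⟨
        A ++ ((Bo ++ b ∷ G) ++ L)              ∎

  Added-embed : ∀ {R tup} → Added T R tup → Added T' R (embed ∘ tup)
  Added-embed {R} {tup} (s , ks , Ts≡ , tup∈) = itemAddr s ys , ks' , T'-label , elems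
    where
      F = subtree T s
      C = subtree C₀ s
      F≡ : F [] ≡ add R ks
      F≡ = trans (subtree-root T s) Ts≡
      cs : Fin (ar Σ' R) → Fin m
      cs i = target (tup i)
      ks' : Fin (ar Σ' R) → Fin K
      ks' i = active (ks i) (finToFun {m} {ar Σ' R} (funToFin cs) i)
      u∈ : add R ks' ∈ gadget (F [])
      u∈ = subst (λ ℓ → add R ks' ∈ gadget ℓ) (sym F≡) (gadget-add-∋ R ks cs)
      ys = proj₁ (∈-∃++ u∈)
      zs = proj₁ (proj₂ (∈-∃++ u∈))
      split : gadget (F []) ≡ ys ++ add R ks' ∷ zs
      split = proj₂ (proj₂ (∈-∃++ u∈))
      T'-label : T' (itemAddr s ys) ≡ add R ks'
      T'-label = trans (cong T' (sym (++-identityʳ _))) (T'-itemAddr s ys _ zs split [])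
      elems : ∀ i → HasElem T' (itemAddr s ys) (embed (tup i)) (ks' i)
      elems i with HasElem→Rep T s (tup∈ i)
      ... | e , r , tup≡ with Rep-expandCore {C = C} r
      ... | z , r' , z↦ =
        castHasElem (trans (embed-itemAddr s ys _ zs split e) (cong embed (sym tup≡))) colour≡
          (Rep→HasElem T' (itemAddr s ys) (λ v → sym (T'-itemAddr s ys _ zs split v))
            (Rep-chain (add R ks' ∷ zs) r'))
        where
          open ≡-Reasoning
          colour≡ : effect (add R ks' ∷ zs) z ≡ ks' i
          colour≡ = begin
            effect (add R ks' ∷ zs) z       ≡⟨ effect-add-suffix (F []) R ks F≡ ys _ split z ⟩
            z                               ≡⟨ effect-add-suffix (F []) R ks F≡ [] _ refl z ⟨
            effect (gadget (F [])) z        ≡⟨ z↦ ⟩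
            active (ks i) (elemColour C e)
              ≡⟨ cong (active (ks i)) (trans (elemColour-subtree s e) (cong target (sym tup≡))) ⟩
            active (ks i) (cs i)            ≡⟨ cong (active (ks i)) (finToFun-funToFin cs i) ⟨
            ks' i                           ∎

  Added-unembed : ∀ {R tup} → Added T' R tup → Added T R (unembed ∘ tup)
  Added-unembed {R} {tup} (w , ks' , T'w≡ , tup∈) with T'-add-position w R ks' T'w≡
  ... | s , ys , zs , refl , split
        with ∈-gadget-add (subtree T s []) R ks' (subst (add R ks' ∈_) (sym split) (∈-++⁺ʳ ys (here refl)))
  ...   | ks , j , F≡ , refl = s , ks , trans (sym (subtree-root T s)) F≡ , elems
    where
      F = subtree T s
      C = subtree C₀ s
      elems : ∀ i → HasElem T s (unembed (tup i)) (ks i)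
      elems i with HasElem→Rep T' (itemAddr s ys) (tup∈ i)
      ... | e , r , tup≡ with Rep-chain⁻ (add R ks' ∷ zs) (Rep-cong (T'-itemAddr s ys _ zs split) r)
      ... | preimage e₀ x z r₀ e≡ y≡ g≡ =
        castHasElem (sym tup↦) (sym x≡) (Rep→HasElem T s (λ _ → refl) r₀)
        where
          open ≡-Reasoning
          tup↦ : unembed (tup i) ≡ prefix s e₀
          tup↦ = begin
            unembed (tup i)                                         ≡⟨ cong unembed tup≡ ⟩
            unembed (prefix (itemAddr s ys) e)
              ≡⟨ cong (unembed ∘ prefix (itemAddr s ys)) e≡ ⟩
            unembed (prefix (itemAddr s ys) (prefix _ (relocate F e₀)))
              ≡⟨ cong unembed (embed-itemAddr s ys _ zs split e₀) ⟩
            unembed (embed (prefix s e₀))                           ≡⟨ unembed-embed _ ⟩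
            prefix s e₀                                             ∎
          colours≡ : ks' i ≡ active x (elemColour C e₀)
          colours≡ = begin
            ks' i                         ≡⟨ y≡ ⟩
            effect (add R ks' ∷ zs) z     ≡⟨ effect-add-suffix (F []) R ks F≡ ys _ split z ⟩
            z                             ≡⟨ effect-add-suffix (F []) R ks F≡ [] _ refl z ⟨
            effect (gadget (F [])) z      ≡⟨ g≡ ⟩
            active x (elemColour C e₀)    ∎
          x≡ : ks i ≡ x
          x≡ = suc-injective (combine-injectiveˡ (suc (ks i)) _ (suc x) _ colours≡)

  T'-iso : ColIso I λ' T'
  T'-iso = record
    { f      = embed ∘ f
    ; g      = g ∘ unembed
    ; f-dom  = λ t t∈ → embed-TreeElem (f-dom t t∈)
    ; g-dom  = λ e e∈ → g-dom (unembed e) (proj₁ (unembed-TreeElem e∈))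
    ; gf     = λ t t∈ → trans (cong g (unembed-embed (f t))) (gf t t∈)
    ; fg     = λ e e∈ → trans (cong embed (fg (unembed e) (proj₁ (unembed-TreeElem e∈))))
                               (sym (proj₂ (unembed-TreeElem e∈)))
    ; f-cnst = λ c c∈ → cong embed (f-cnst c c∈)
    ; g-cnst = λ c c∈ → g-cnst c (proj₁ (unembed-TreeElem c∈))
    ; top-f  = λ t t⊤ → embed-TreeElem (top-f t t⊤)
    ; top-g  = λ e e∈ → top-g (unembed e) (proj₁ (unembed-TreeElem e∈))
    ; rel-f  = λ R tup r → Added-embed (rel-f R tup r)
    ; rel-g  = λ R tup a → rel-g R (unembed ∘ tup) (Added-unembed a)
    ; colour = λ t t' κ κ' t∈ t'∈ h h' →
        (λ λ'≡ → trans (root-colour t κ t∈ h) (trans (cong retired λ'≡) (sym (root-colour t' κ' t'∈ h')))) ,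
        (λ κ≡ → combine-injectiveʳ {suc n} zero (λ' t) zero (λ' t')
                  (trans (sym (root-colour t κ t∈ h)) (trans κ≡ (root-colour t' κ' t'∈ h'))))
    }

lemma27 : (Σ' : Signature) (I : Instance Σ') → FinitelyManyConstants I →
          (n : ℕ) → cw≡ I n →
          (m : ℕ) (λ' : Term → Fin m) →
          cwCol≤ I λ' (suc n * m)
lemma27 Σ' I _ n ((_ , _ , T , T-wd , iso) , _) m λ' =
  suc n * m , ≤-refl , T' , T'-wd , T'-iso
  where open Recoloured Σ' n m I λ' T T-wd iso
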